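{- If $A=\{1,2,\dots,n\}$ and $\mu$ is a partition of $n$, then $|\mathcal{C}_A(\mu)|=\binom{n}{\mu}=\dfrac{n!}{\mu_1!\mu_2!\cdots}$.
   Context: A word on $\{0,1,2,\dots\}$ is Yamanouchi if every suffix contains at least as many $i$'s as $(i+1)$'s for all $i\ge0$; it has content $\mu$ if exactly $\mu_i$ letters equal $i-1$. A word $w_1\cdots w_n$ is $\mu$-sub-Yamanouchi if there is a Yamanouchi word $v$ of content $\mu$ with $w_i\le v_i$ for all $i$. The monomial of $c=c_1\cdots c_n$ is $x^c=x_n^{c_1}\cdots x_1^{c_n}$; $\mathcal{C}_{\{1,\dots,n\}}(\mu)$ is the set of monomials of $\mu$-sub-Yamanouchi words of length $n$. -}

module Defs where

open import Data.Nat using (ℕ; zero; suc; _≤_; _<_; _≟_)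
open import Data.List using (List; []; _∷_; drop)
open import Data.Nat.ListAction using (sum)
open import Data.List.Relation.Unary.All using (All)
open import Data.List.Relation.Unary.Linked using (Linked)
open import Data.Vec using (Vec; toList; reverse)
open import Data.Vec.Relation.Binary.Pointwise.Inductive using (Pointwise)
open import Data.Product using (Σ; _×_; ∃)
open import Relation.Binary.PropositionalEquality using (_≡_)
open import Relation.Nullary using (yes; no)
open import Data.Nat.Combinatorics using ()

count : ℕ → List ℕ → ℕ
count a [] = 0
count a (x ∷ xs) with a ≟ x
... | yes _ = suc (count a xs)
... | no  _ = count a xs

IsPartition : ℕ → List ℕ → Set
IsPartition n μ = All (λ p → 0 < p) μ × Linked (λ a b → b ≤ a) μ × sum μ ≡ n

-- μ-part at 0-based index j (i.e. μ_{j+1}), zero beyond the length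
part : List ℕ → ℕ → ℕ
part [] j = 0
part (p ∷ μ) zero = p
part (p ∷ μ) (suc j) = part μ j

Yamanouchi : List ℕ → Set
Yamanouchi w = ∀ (k i : ℕ) → count (suc i) (drop k w) ≤ count i (drop k w)

HasContent : List ℕ → List ℕ → Set
HasContent μ w = ∀ (j : ℕ) → count j w ≡ part μ j

SubYamanouchi : (μ : List ℕ) {n : ℕ} → Vec ℕ n → Set
SubYamanouchi μ {n} w =
  Σ (Vec ℕ n) λ v → Yamanouchi (toList v) × HasContent μ (toList v) × Pointwise _≤_ w v

-- A monomial in x_1,…,x_n is its exponent vector (e_1,…,e_n), e_j the exponent of x_j.
Monomial : ℕ → Set
Monomial n = Vec ℕ n

-- x^c = x_n^{c_1} ⋯ x_1^{c_n}: the exponent of x_j is c_{n+1-j}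
monomialOf : {n : ℕ} → Vec ℕ n → Monomial n
monomialOf c = reverse c

InC : (n : ℕ) (μ : List ℕ) → Monomial n → Set
InC n μ m = ∃ λ (w : Vec ℕ n) → SubYamanouchi μ w × monomialOf w ≡ m

-- The first letter a of a μ-sub-Yamanouchi word can be any row index with μ_a > 0, and
-- the remaining letters then form exactly the (μ − e_G)-sub-Yamanouchi words, where G is
-- the last row of μ as long as row a (the removable corner below a).  The nontrivial
-- inclusion rests on a raising lemma: a Yamanouchi word whose content is ν with one box
-- moved from a row Q up to a row P < Q can be raised letterwise to a Yamanouchi word of
-- content ν.  Since μ_G = μ_a and Σ_a μ_a = n, the count satisfies the multinomial
-- recursion  N(μ) = Σ_a (n − 1)! μ_a / ∏ μ! = n! / ∏ μ!.
module Submission where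

open import Defs
open import Data.Nat using (ℕ; _*_; _!)
open import Data.List using (List; length; map)
open import Data.Nat.ListAction using (product)
open import Data.List.Relation.Unary.Unique.Propositional using (Unique)
open import Data.List.Membership.Propositional using (_∈_)
open import Data.Product using (Σ; _×_)
open import Function.Bundles using (_⇔_)
open import Relation.Binary.PropositionalEquality using (_≡_)

open import Data.Empty using (⊥)
open import Data.List using ([]; _∷_; _++_)
open import Data.Nat.ListAction using (sum)
open import Data.List.Membership.Propositional.Properties using (∈-map⁺; ∈-map⁻; ∈-++⁺ˡ; ∈-++⁺ʳ; ∈-++⁻)
open import Data.List.Properties using (length-map; length-++; map-∘; map-cong-local)
open import Data.List.Relation.Unary.All as All using ([]; _∷_)
open import Data.List.Relation.Unary.AllPairs using ([]; _∷_)
open import Data.List.Relation.Unary.Any using (here; there)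
open import Data.List.Relation.Unary.Linked using (Linked; []; [-]; _∷_)
import Data.List.Relation.Unary.Unique.Propositional.Properties as Unique
open import Data.Nat using (zero; suc; _+_; _∸_; _≤_; _<_; _≟_; _≤?_; z≤n; s≤s)
open import Data.Nat.Properties
open import Algebra.Properties.CommutativeSemigroup +-commutativeSemigroup using (x∙yz≈y∙xz)
open import Data.Product using (_,_; proj₁; ∃; map₁)
open import Data.Sum using (inj₁; inj₂)
open import Data.Unit using (⊤; tt)
open import Data.Vec using (Vec; []; _∷_; toList; reverse)
open import Data.Vec.Properties using (∷-injectiveʳ; reverse-injective)
open import Data.Vec.Relation.Binary.Pointwise.Inductive as Pointwise using (Pointwise; []; _∷_)
open import Function using (_∘_)
open import Function.Bundles using (mk⇔; Equivalence)
open import Relation.Binary.PropositionalEquality using (_≢_; _≗_; refl; sym; trans; cong; cong₂; subst; subst₂; module ≡-Reasoning)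
open import Relation.Nullary using (¬_; yes; no; contradiction)

δ : ℕ → ℕ → ℕ
δ zero    zero    = 1
δ zero    (suc b) = 0
δ (suc a) zero    = 0
δ (suc a) (suc b) = δ a b

δ-refl : ∀ a → δ a a ≡ 1
δ-refl zero    = refl
δ-refl (suc a) = δ-refl a

δ-≡ : ∀ {a b} → a ≡ b → δ a b ≡ 1
δ-≡ {a} refl = δ-refl a

δ-≢ : ∀ {a b} → a ≢ b → δ a b ≡ 0
δ-≢ {zero}  {zero}  a≢b = contradiction refl a≢b
δ-≢ {zero}  {suc b} a≢b = refl
δ-≢ {suc a} {zero}  a≢b = refl
δ-≢ {suc a} {suc b} a≢b = δ-≢ (a≢b ∘ cong suc)

δ-suc-self : ∀ a → δ (suc a) a ≡ 0
δ-suc-self zero    = refl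
δ-suc-self (suc a) = δ-suc-self a

δ-≤ : ∀ (ν : ℕ → ℕ) {X} → 0 < ν X → ∀ j → δ j X ≤ ν j
δ-≤ ν {X} ν[X]>0 j with j ≟ X
... | yes refl = subst (_≤ ν j) (sym (δ-refl j)) ν[X]>0
... | no  j≢X  = subst (_≤ ν j) (sym (δ-≢ j≢X)) z≤n

count-∷ : ∀ a x xs → count a (x ∷ xs) ≡ δ a x + count a xs
count-∷ a x xs with a ≟ x
... | yes a≡x = cong (_+ count a xs) (sym (δ-≡ a≡x))
... | no  a≢x = cong (_+ count a xs) (sym (δ-≢ a≢x))

-- Contents are functions ℕ → ℕ: ν j is the number of letters j, i.e. the length of row j + 1.
Decreasing : (ℕ → ℕ) → Set
Decreasing ν = ∀ i → ν (suc i) ≤ ν i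

decreasing-cong : ∀ {ν κ} → ν ≗ κ → Decreasing κ → Decreasing ν
decreasing-cong ν≗κ κ↓ i = subst₂ _≤_ (sym (ν≗κ (suc i))) (sym (ν≗κ i)) (κ↓ i)

decreasing⇒antitone : ∀ {ν} → Decreasing ν → ∀ {i j} → i ≤ j → ν j ≤ ν i
decreasing⇒antitone ν↓ {i} {zero}  z≤n = ≤-refl
decreasing⇒antitone ν↓ {i} {suc j} i≤1+j with m≤n⇒m<n∨m≡n i≤1+j
... | inj₂ refl      = ≤-refl
... | inj₁ (s≤s i≤j) = ≤-trans (ν↓ j) (decreasing⇒antitone ν↓ i≤j)

_⊖_ : (ℕ → ℕ) → ℕ → ℕ → ℕ
(ν ⊖ X) j = ν j ∸ δ j X

δ+⊖ : ∀ (ν : ℕ → ℕ) {X} → 0 < ν X → ∀ j → δ j X + (ν ⊖ X) j ≡ ν j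
δ+⊖ ν {X} ν[X]>0 j = m+[n∸m]≡n (δ-≤ ν {X} ν[X]>0 j)

⊖-decreasing : ∀ {ν X} → Decreasing ν → ν (suc X) < ν X → Decreasing (ν ⊖ X)
⊖-decreasing {ν} {X} ν↓ corner i with i ≟ X
... | yes refl rewrite δ-suc-self i | δ-refl i = ∸-monoˡ-≤ 1 corner
... | no  i≢X  rewrite δ-≢ i≢X = ≤-trans (m∸n≤m (ν (suc i)) (δ (suc i) X)) (ν↓ i)

counts : ∀ {n} → Vec ℕ n → ℕ → ℕ
counts v j = count j (toList v)

counts-∷ : ∀ {n} c (v : Vec ℕ n) j → counts (c ∷ v) j ≡ δ j c + counts v j
counts-∷ c v j = count-∷ j c (toList v)

Content : ∀ {n} → Vec ℕ n → (ℕ → ℕ) → Set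
Content v ν = counts v ≗ ν

content-∷ : ∀ {n} {ν X} {w : Vec ℕ n} → 0 < ν X → Content w (ν ⊖ X) → Content (X ∷ w) ν
content-∷ {ν = ν} {X} {w} ν[X]>0 w∼ν⊖X j = begin
  counts (X ∷ w) j     ≡⟨ counts-∷ X w j ⟩
  δ j X + counts w j   ≡⟨ cong (δ j X +_) (w∼ν⊖X j) ⟩
  δ j X + (ν ⊖ X) j    ≡⟨ δ+⊖ ν ν[X]>0 j ⟩
  ν j                  ∎
  where open ≡-Reasoning

IsYamanouchi : ∀ {n} → Vec ℕ n → Set
IsYamanouchi v = Yamanouchi (toList v)

yamanouchi-[] : IsYamanouchi []
yamanouchi-[] zero    i = z≤n
yamanouchi-[] (suc k) i = z≤n

yamanouchi-tail : ∀ {n c} {v : Vec ℕ n} → IsYamanouchi (c ∷ v) → IsYamanouchi v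
yamanouchi-tail yam k = yam (suc k)

yamanouchi⇒decreasing : ∀ {n} {v : Vec ℕ n} → IsYamanouchi v → Decreasing (counts v)
yamanouchi⇒decreasing yam = yam 0

yamanouchi-∷ : ∀ {n c} {v : Vec ℕ n} → IsYamanouchi v → Decreasing (counts (c ∷ v)) →
               IsYamanouchi (c ∷ v)
yamanouchi-∷ yam head↓ zero    = head↓
yamanouchi-∷ yam head↓ (suc k) = yam k

-- SubYamanouchi μ is, by definition, SubYam (part μ).
SubYam : (ℕ → ℕ) → ∀ {n} → Vec ℕ n → Set
SubYam ν {n} w = Σ (Vec ℕ n) λ v → IsYamanouchi v × Content v ν × Pointwise _≤_ w v

subYam-cong : ∀ {n ν κ} {w : Vec ℕ n} → ν ≗ κ → SubYam ν w → SubYam κ w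
subYam-cong ν≗κ (v , yam , v∼ν , w≤v) = v , yam , (λ j → trans (v∼ν j) (ν≗κ j)) , w≤v

subYam-downward : ∀ {n ν} {u w : Vec ℕ n} → Pointwise _≤_ u w → SubYam ν w → SubYam ν u
subYam-downward u≤w (v , yam , v∼ν , w≤v) = v , yam , v∼ν , Pointwise.trans ≤-trans u≤w w≤v

∷-subYam : ∀ {n ν X c} {w : Vec ℕ n} → Decreasing ν → 0 < ν X → c ≤ X →
           SubYam (ν ⊖ X) w → SubYam ν (c ∷ w)
∷-subYam {ν = ν} {X} ν↓ ν[X]>0 c≤X (v , yam , v∼ν⊖X , w≤v) =
  X ∷ v , yamanouchi-∷ yam (decreasing-cong Xv∼ν ν↓) , Xv∼ν , c≤X ∷ w≤v
  where
  Xv∼ν : Content (X ∷ v) ν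
  Xv∼ν = content-∷ ν[X]>0 v∼ν⊖X

-- κ = ν + e_P − e_Q, with both sides moved so that no subtraction occurs.
Shifted : ℕ → ℕ → (ℕ → ℕ) → (ℕ → ℕ) → Set
Shifted P Q κ ν = ∀ j → δ j Q + κ j ≡ δ j P + ν j

shifted-cong : ∀ {P Q : ℕ} {κ κ′ ν : ℕ → ℕ} → κ ≗ κ′ → Shifted P Q κ ν → Shifted P Q κ′ ν
shifted-cong {Q = Q} κ≗κ′ sh j = trans (cong (δ j Q +_) (sym (κ≗κ′ j))) (sh j)

shifted-swap : ∀ {P Q X : ℕ} {κ ν : ℕ → ℕ} → Shifted P Q (λ j → δ j X + κ j) ν →
               Shifted P X (λ j → δ j Q + κ j) ν
shifted-swap {Q = Q} {X} {κ} sh j = trans (x∙yz≈y∙xz (δ j X) (δ j Q) (κ j)) (sh j)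

shifted-cancel : ∀ {P Q : ℕ} {κ ν : ℕ → ℕ} → Shifted P Q (λ j → δ j P + κ j) ν →
                 (λ j → δ j Q + κ j) ≗ ν
shifted-cancel {P} sh j = +-cancelˡ-≡ (δ j P) _ _ (shifted-swap sh j)

shifted-⊖ : ∀ {P X Y : ℕ} {κ ν : ℕ → ℕ} → Shifted P X (λ j → δ j Y + κ j) ν → 0 < ν X →
            Shifted P Y κ (ν ⊖ X)
shifted-⊖ {P} {X} {Y} {κ} {ν} sh ν[X]>0 j = +-cancelˡ-≡ (δ j X) _ _ (begin
  δ j X + (δ j Y + κ j)        ≡⟨ sh j ⟩
  δ j P + ν j                  ≡⟨ cong (δ j P +_) (sym (δ+⊖ ν ν[X]>0 j)) ⟩
  δ j P + (δ j X + (ν ⊖ X) j)  ≡⟨ x∙yz≈y∙xz (δ j P) (δ j X) _ ⟩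
  δ j X + (δ j P + (ν ⊖ X) j)  ∎)
  where open ≡-Reasoning

shifted-corner : ∀ {P Q : ℕ} {κ ν : ℕ → ℕ} → P ≢ Q → Shifted P Q κ ν →
                 κ (suc Q) ≤ κ Q → ν (suc Q) < ν Q
shifted-corner {P} {Q} {κ} {ν} P≢Q sh κ↓ = begin-strict
  ν (suc Q)                ≤⟨ m≤n+m (ν (suc Q)) (δ (suc Q) P) ⟩
  δ (suc Q) P + ν (suc Q)  ≡⟨ sym (sh (suc Q)) ⟩
  δ (suc Q) Q + κ (suc Q)  ≡⟨ cong (_+ κ (suc Q)) (δ-suc-self Q) ⟩
  κ (suc Q)                ≤⟨ κ↓ ⟩
  κ Q                      <⟨ n<1+n (κ Q) ⟩
  suc (κ Q)                ≡⟨ cong (_+ κ Q) (sym (δ-refl Q)) ⟩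
  δ Q Q + κ Q              ≡⟨ sh Q ⟩
  δ Q P + ν Q              ≡⟨ cong (_+ ν Q) (δ-≢ (P≢Q ∘ sym)) ⟩
  ν Q                      ∎
  where open ≤-Reasoning

shifted-[] : ∀ {P Q : ℕ} {ν : ℕ → ℕ} → P < Q → ¬ Shifted P Q (counts []) ν
shifted-[] {P} {Q} {ν} P<Q sh = 0≢1+n (begin
  0                ≡⟨ cong (_+ 0) (sym (δ-≢ (<⇒≢ P<Q))) ⟩
  δ P Q + 0        ≡⟨ sh P ⟩
  δ P P + ν P      ≡⟨ cong (_+ ν P) (δ-refl P) ⟩
  suc (ν P)        ∎)
  where open ≡-Reasoning

raise : ∀ {n} (v : Vec ℕ n) {P Q ν} → P < Q → IsYamanouchi v → Decreasing ν →
        Shifted P Q (counts v) ν → SubYam ν v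
raise []      P<Q yam ν↓ sh = contradiction sh (shifted-[] P<Q)
raise (c ∷ v) {P} {Q} {ν} P<Q yam ν↓ sh = byHead
  where
  sh′ : Shifted P Q (λ j → δ j c + counts v j) ν
  sh′ = shifted-cong (counts-∷ c v) sh

  replaceHead : c ≡ P → SubYam ν (c ∷ v)
  replaceHead refl = Q ∷ v , yamanouchi-∷ (yamanouchi-tail yam) (decreasing-cong Qv∼ν ν↓) ,
                     Qv∼ν , <⇒≤ P<Q ∷ Pointwise.refl ≤-refl
    where
    Qv∼ν : Content (Q ∷ v) ν
    Qv∼ν j = trans (counts-∷ Q v j) (shifted-cancel sh′ j)

  raiseHead : P < c → c ≤ Q → SubYam ν (c ∷ v)
  raiseHead P<c c≤Q = ∷-subYam ν↓ ν[Q]>0 c≤Q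
    (raise v P<c (yamanouchi-tail yam) (⊖-decreasing ν↓ corner) (shifted-⊖ sh′ ν[Q]>0))
    where
    corner : ν (suc Q) < ν Q
    corner = shifted-corner (<⇒≢ P<Q) sh (yamanouchi⇒decreasing yam Q)
    ν[Q]>0 : 0 < ν Q
    ν[Q]>0 = m<n⇒0<n corner

  keepHead : c ≢ P → c ≢ Q → suc c ≢ Q → SubYam ν (c ∷ v)
  keepHead c≢P c≢Q 1+c≢Q = ∷-subYam ν↓ ν[c]>0 ≤-refl
    (raise v P<Q (yamanouchi-tail yam) (⊖-decreasing ν↓ corner) (shifted-⊖ swapped ν[c]>0))
    where
    κ↓ : δ (suc c) Q + counts v (suc c) ≤ δ c Q + counts v c
    κ↓ rewrite δ-≢ 1+c≢Q | δ-≢ c≢Q = yamanouchi⇒decreasing (yamanouchi-tail yam) c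
    swapped : Shifted P c (λ j → δ j Q + counts v j) ν
    swapped = shifted-swap sh′
    corner : ν (suc c) < ν c
    corner = shifted-corner (c≢P ∘ sym) swapped κ↓
    ν[c]>0 : 0 < ν c
    ν[c]>0 = m<n⇒0<n corner

  -- If Q = c + 1 the head cannot be kept: ν (suc c) < ν c may fail.
  byHead : SubYam ν (c ∷ v)
  byHead with c ≟ P | c ≟ Q | suc c ≟ Q
  ... | yes c≡P | _       | _        = replaceHead c≡P
  ... | no  _   | yes c≡Q | _        = raiseHead (subst (P <_) (sym c≡Q) P<Q) (≤-reflexive c≡Q)
  ... | no  c≢P | no  _   | yes 1+c≡Q =
    raiseHead (≤∧≢⇒< (≤-pred (subst (P <_) (sym 1+c≡Q) P<Q)) (c≢P ∘ sym))
              (subst (c ≤_) 1+c≡Q (n≤1+n c))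
  ... | no  c≢P | no  c≢Q | no  1+c≢Q = keepHead c≢P c≢Q 1+c≢Q

content-tail : ∀ {n c ν} {v : Vec ℕ n} → Content (c ∷ v) ν → Content v (ν ⊖ c)
content-tail {c = c} {ν} {v} cv∼ν j = begin
  counts v j                    ≡⟨ sym (m+n∸m≡n (δ j c) (counts v j)) ⟩
  (δ j c + counts v j) ∸ δ j c  ≡⟨ cong (_∸ δ j c) (trans (sym (counts-∷ c v j)) (cv∼ν j)) ⟩
  ν j ∸ δ j c                   ∎
  where open ≡-Reasoning

yamanouchi-corner : ∀ {n c ν} {v : Vec ℕ n} → IsYamanouchi (c ∷ v) → Content (c ∷ v) ν →
                    ν (suc c) < ν c
yamanouchi-corner {c = c} {ν} {v} yam cv∼ν = begin-strict
  ν (suc c)                          ≡⟨ trans (sym (cv∼ν (suc c))) (counts-∷ c v (suc c)) ⟩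
  δ (suc c) c + counts v (suc c)     ≡⟨ cong (_+ counts v (suc c)) (δ-suc-self c) ⟩
  counts v (suc c)                   ≤⟨ yamanouchi⇒decreasing (yamanouchi-tail yam) c ⟩
  counts v c                         <⟨ n<1+n (counts v c) ⟩
  suc (counts v c)                   ≡⟨ cong (_+ counts v c) (sym (δ-refl c)) ⟩
  δ c c + counts v c                 ≡⟨ trans (sym (counts-∷ c v c)) (cv∼ν c) ⟩
  ν c                                ∎
  where open ≤-Reasoning

tail-subYam : ∀ {n c G ν} {v : Vec ℕ n} → Decreasing ν → IsYamanouchi (c ∷ v) →
              Content (c ∷ v) ν → G ≤ c → ν (suc G) < ν G → SubYam (ν ⊖ G) v
tail-subYam {c = c} {G} {ν} {v} ν↓ yam cv∼ν G≤c corner with m≤n⇒m<n∨m≡n G≤c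
... | inj₂ refl = v , yamanouchi-tail yam , content-tail cv∼ν , Pointwise.refl ≤-refl
... | inj₁ G<c  = raise v G<c (yamanouchi-tail yam) (⊖-decreasing ν↓ corner) shifted
  where
  shifted : Shifted G c (counts v) (ν ⊖ G)
  shifted j = trans (sym (counts-∷ c v j)) (trans (cv∼ν j) (sym (δ+⊖ ν (m<n⇒0<n corner) j)))

removeBox : List ℕ → ℕ → List ℕ
removeBox []      _       = []
removeBox (p ∷ μ) zero    = p ∸ 1 ∷ μ
removeBox (p ∷ μ) (suc i) = p ∷ removeBox μ i

part-removeBox : ∀ μ i → part (removeBox μ i) ≗ part μ ⊖ i
part-removeBox []      i       j       = sym (0∸n≡0 (δ j i))
part-removeBox (p ∷ μ) zero    zero    = refl
part-removeBox (p ∷ μ) zero    (suc j) = refl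
part-removeBox (p ∷ μ) (suc i) zero    = refl
part-removeBox (p ∷ μ) (suc i) (suc j) = part-removeBox μ i j

sum-removeBox : ∀ μ i → 0 < part μ i → suc (sum (removeBox μ i)) ≡ sum μ
sum-removeBox (suc p ∷ μ) zero    _      = refl
sum-removeBox (p ∷ μ)     (suc i) μ[i]>0 =
  trans (sym (+-suc p _)) (cong (p +_) (sum-removeBox μ i μ[i]>0))

part-zero : ∀ μ → sum μ ≡ 0 → ∀ j → part μ j ≡ 0
part-zero []      _    j       = refl
part-zero (p ∷ μ) Σμ≡0 zero    = m+n≡0⇒m≡0 p Σμ≡0
part-zero (p ∷ μ) Σμ≡0 (suc j) = part-zero μ (m+n≡0⇒n≡0 p Σμ≡0) j

∏! : List ℕ → ℕ
∏! μ = product (map _! μ)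

∏!-removeBox : ∀ μ i → 0 < part μ i → ∏! (removeBox μ i) * part μ i ≡ ∏! μ
∏!-removeBox (suc p ∷ μ) zero _ =
  trans (*-comm (p ! * ∏! μ) (suc p)) (sym (*-assoc (suc p) (p !) (∏! μ)))
∏!-removeBox (p ∷ μ) (suc i) μ[i]>0 =
  trans (*-assoc (p !) _ _) (cong (p ! *_) (∏!-removeBox μ i μ[i]>0))

∏!-zero : ∀ μ → sum μ ≡ 0 → ∏! μ ≡ 1
∏!-zero []      _    = refl
∏!-zero (p ∷ μ) Σμ≡0 rewrite m+n≡0⇒m≡0 p Σμ≡0 | ∏!-zero μ (m+n≡0⇒n≡0 p Σμ≡0) = refl

lastInRun : ℕ → List ℕ → ℕ
lastInRun p []      = 0
lastInRun p (q ∷ μ) with p ≟ q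
... | yes _ = suc (lastInRun q μ)
... | no  _ = 0

-- The last row of μ whose length equals that of row a (a itself beyond the rows of μ).
corner : List ℕ → ℕ → ℕ
corner []      a       = a
corner (p ∷ μ) zero    = lastInRun p μ
corner (p ∷ μ) (suc a) = suc (corner μ a)

≤-corner : ∀ μ a → a ≤ corner μ a
≤-corner []      a       = ≤-refl
≤-corner (p ∷ μ) zero    = z≤n
≤-corner (p ∷ μ) (suc a) = s≤s (≤-corner μ a)

part-lastInRun : ∀ p μ → part (p ∷ μ) (lastInRun p μ) ≡ p
part-lastInRun p []      = refl
part-lastInRun p (q ∷ μ) with p ≟ q
... | yes p≡q = trans (part-lastInRun q μ) (sym p≡q)
... | no  _   = refl

part-corner : ∀ μ a → part μ (corner μ a) ≡ part μ a
part-corner []      a       = refl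
part-corner (p ∷ μ) zero    = part-lastInRun p μ
part-corner (p ∷ μ) (suc a) = part-corner μ a

lastInRun-removable : ∀ p μ → Decreasing (part (p ∷ μ)) → 0 < p → part μ (lastInRun p μ) < p
lastInRun-removable p []      _  p>0 = p>0
lastInRun-removable p (q ∷ μ) μ↓ p>0 with p ≟ q
... | yes refl = lastInRun-removable p μ (μ↓ ∘ suc) p>0
... | no  p≢q  = ≤∧≢⇒< (μ↓ 0) (p≢q ∘ sym)

corner-removable : ∀ μ a → Decreasing (part μ) → 0 < part μ a →
                   part μ (suc (corner μ a)) < part μ (corner μ a)
corner-removable (p ∷ μ) zero μ↓ μ[a]>0 =
  subst (part μ (lastInRun p μ) <_) (sym (part-lastInRun p μ))
        (lastInRun-removable p μ μ↓ μ[a]>0)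
corner-removable (p ∷ μ) (suc a) μ↓ μ[a]>0 = corner-removable μ a (μ↓ ∘ suc) μ[a]>0

corner-maximal : ∀ μ {a c} → Decreasing (part μ) → a ≤ c → part μ (suc c) < part μ c →
                 corner μ a ≤ c
corner-maximal μ {a} {c} μ↓ a≤c c-removable with corner μ a ≤? c
... | yes G≤c = G≤c
... | no  G≰c = contradiction (begin-strict
  part μ (corner μ a)  ≤⟨ decreasing⇒antitone μ↓ (≰⇒> G≰c) ⟩
  part μ (suc c)       <⟨ c-removable ⟩
  part μ c             ≤⟨ decreasing⇒antitone μ↓ a≤c ⟩
  part μ a             ≡⟨ sym (part-corner μ a) ⟩
  part μ (corner μ a)  ∎) (<-irrefl refl)
  where open ≤-Reasoning

-- A partition of n, possibly padded with zero parts (removing a box may create one).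
Shape : ℕ → List ℕ → Set
Shape n μ = Decreasing (part μ) × sum μ ≡ n

removeCorner : List ℕ → ℕ → List ℕ
removeCorner μ a = removeBox μ (corner μ a)

shape-removeCorner : ∀ {n} μ a → Shape (suc n) μ → 0 < part μ a → Shape n (removeCorner μ a)
shape-removeCorner μ a (μ↓ , Σμ) μ[a]>0 =
  decreasing-cong (part-removeBox μ G) (⊖-decreasing μ↓ G-removable) ,
  suc-injective (trans (sum-removeBox μ G (m<n⇒0<n G-removable)) Σμ)
  where
  G : ℕ
  G = corner μ a
  G-removable : part μ (suc G) < part μ G
  G-removable = corner-removable μ a μ↓ μ[a]>0

Admissible : ∀ {n} → List ℕ → Vec ℕ n → Set
Admissible μ []      = ⊤
Admissible μ (a ∷ w) = 0 < part μ a × Admissible (removeCorner μ a) w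

admissible⇒subYamanouchi : ∀ {n} μ (w : Vec ℕ n) → Shape n μ → Admissible μ w →
                           SubYamanouchi μ w
admissible⇒subYamanouchi μ [] (_ , Σμ≡0) _ = [] , yamanouchi-[] , (sym ∘ part-zero μ Σμ≡0) , []
admissible⇒subYamanouchi μ (a ∷ w) shape@(μ↓ , _) (μ[a]>0 , adm) =
  ∷-subYam μ↓ (m<n⇒0<n G-removable) (≤-corner μ a)
    (subYam-cong (part-removeBox μ G)
      (admissible⇒subYamanouchi (removeCorner μ a) w (shape-removeCorner μ a shape μ[a]>0) adm))
  where
  G : ℕ
  G = corner μ a
  G-removable : part μ (suc G) < part μ G
  G-removable = corner-removable μ a μ↓ μ[a]>0

subYamanouchi⇒admissible : ∀ {n} μ (w : Vec ℕ n) → Shape n μ → SubYamanouchi μ w →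
                           Admissible μ w
subYamanouchi⇒admissible μ [] _ _ = tt
subYamanouchi⇒admissible μ (a ∷ w) shape@(μ↓ , _) (c ∷ v , yam , cv∼μ , a≤c ∷ w≤v) =
  μ[a]>0 ,
  subYamanouchi⇒admissible (removeCorner μ a) w (shape-removeCorner μ a shape μ[a]>0)
    (subYam-cong (sym ∘ part-removeBox μ G)
      (subYam-downward w≤v (tail-subYam μ↓ yam cv∼μ G≤c (corner-removable μ a μ↓ μ[a]>0))))
  where
  G : ℕ
  G = corner μ a
  c-removable : part μ (suc c) < part μ c
  c-removable = yamanouchi-corner yam cv∼μ
  μ[a]>0 : 0 < part μ a
  μ[a]>0 = ≤-trans (m<n⇒0<n c-removable) (decreasing⇒antitone μ↓ a≤c)
  G≤c : G ≤ c
  G≤c = corner-maximal μ μ↓ a≤c c-removable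

nonemptyRows : List ℕ → List ℕ
nonemptyRows []          = []
nonemptyRows (zero ∷ μ)  = map suc (nonemptyRows μ)
nonemptyRows (suc p ∷ μ) = 0 ∷ map suc (nonemptyRows μ)

∈-nonemptyRows⁻ : ∀ μ {a} → a ∈ nonemptyRows μ → 0 < part μ a
∈-nonemptyRows⁻ (zero ∷ μ) a∈ with ∈-map⁻ suc a∈
... | b , b∈ , refl = ∈-nonemptyRows⁻ μ b∈
∈-nonemptyRows⁻ (suc p ∷ μ) (here refl) = s≤s z≤n
∈-nonemptyRows⁻ (suc p ∷ μ) (there a∈) with ∈-map⁻ suc a∈
... | b , b∈ , refl = ∈-nonemptyRows⁻ μ b∈

∈-nonemptyRows⁺ : ∀ μ a → 0 < part μ a → a ∈ nonemptyRows μ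
∈-nonemptyRows⁺ (zero ∷ μ)  (suc a) μ[a]>0 = ∈-map⁺ suc (∈-nonemptyRows⁺ μ a μ[a]>0)
∈-nonemptyRows⁺ (suc p ∷ μ) zero    _      = here refl
∈-nonemptyRows⁺ (suc p ∷ μ) (suc a) μ[a]>0 = there (∈-map⁺ suc (∈-nonemptyRows⁺ μ a μ[a]>0))

nonemptyRows-unique : ∀ μ → Unique (nonemptyRows μ)
nonemptyRows-unique []          = []
nonemptyRows-unique (zero ∷ μ)  = Unique.map⁺ suc-injective (nonemptyRows-unique μ)
nonemptyRows-unique (suc p ∷ μ) =
  All.tabulate 0∉ ∷ Unique.map⁺ suc-injective (nonemptyRows-unique μ)
  where
  0∉ : ∀ {b} → b ∈ map suc (nonemptyRows μ) → 0 ≢ b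
  0∉ b∈ with ∈-map⁻ suc b∈
  ... | _ , _ , refl = 0≢1+n

sum-part-nonemptyRows : ∀ μ → sum (map (part μ) (nonemptyRows μ)) ≡ sum μ
sum-part-nonemptyRows []          = refl
sum-part-nonemptyRows (zero ∷ μ)  =
  trans (cong sum (sym (map-∘ (nonemptyRows μ)))) (sum-part-nonemptyRows μ)
sum-part-nonemptyRows (suc p ∷ μ) =
  cong (suc p +_) (trans (cong sum (sym (map-∘ (nonemptyRows μ)))) (sum-part-nonemptyRows μ))

prefixWith : ∀ {A : Set} {n} → (A → List (Vec A n)) → List A → List (Vec A (suc n))
prefixWith f []       = []
prefixWith f (a ∷ as) = map (a ∷_) (f a) ++ prefixWith f as

∈-prefixWith⁻ : ∀ {A : Set} {n} (f : A → List (Vec A n)) as {a w} →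
                (a ∷ w) ∈ prefixWith f as → a ∈ as × w ∈ f a
∈-prefixWith⁻ f (b ∷ as) aw∈ with ∈-++⁻ (map (b ∷_) (f b)) aw∈
... | inj₁ aw∈bf with ∈-map⁻ (b ∷_) aw∈bf
...   | _ , w∈ , refl = here refl , w∈
∈-prefixWith⁻ f (b ∷ as) aw∈ | inj₂ aw∈rest = map₁ there (∈-prefixWith⁻ f as aw∈rest)

∈-prefixWith⁺ : ∀ {A : Set} {n} (f : A → List (Vec A n)) {as a w} →
                a ∈ as → w ∈ f a → (a ∷ w) ∈ prefixWith f as
∈-prefixWith⁺ f {a ∷ _}  (here refl) w∈ = ∈-++⁺ˡ (∈-map⁺ (a ∷_) w∈)
∈-prefixWith⁺ f {b ∷ _}  (there a∈)  w∈ = ∈-++⁺ʳ (map (b ∷_) (f b)) (∈-prefixWith⁺ f a∈ w∈)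

prefixWith-unique : ∀ {A : Set} {n} (f : A → List (Vec A n)) {as} →
                    Unique as → (∀ a → Unique (f a)) → Unique (prefixWith f as)
prefixWith-unique f {[]}     []           _        = []
prefixWith-unique f {a ∷ as} (a∉as ∷ as!) f-unique =
  Unique.++⁺ (Unique.map⁺ ∷-injectiveʳ (f-unique a)) (prefixWith-unique f as! f-unique) disjoint
  where
  disjoint : ∀ {x} → x ∈ map (a ∷_) (f a) × x ∈ prefixWith f as → ⊥
  disjoint (x∈af , x∈rest) with ∈-map⁻ (a ∷_) x∈af
  ... | w , _ , refl = All.lookup a∉as (proj₁ (∈-prefixWith⁻ f as x∈rest)) refl

length-prefixWith : ∀ {A : Set} {n} (f : A → List (Vec A n)) as →
                    length (prefixWith f as) ≡ sum (map (length ∘ f) as)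
length-prefixWith f []       = refl
length-prefixWith f (a ∷ as) = begin
  length (map (a ∷_) (f a) ++ prefixWith f as)
    ≡⟨ length-++ (map (a ∷_) (f a)) ⟩
  length (map (a ∷_) (f a)) + length (prefixWith f as)
    ≡⟨ cong₂ _+_ (length-map (a ∷_) (f a)) (length-prefixWith f as) ⟩
  length (f a) + sum (map (length ∘ f) as)
    ∎
  where open ≡-Reasoning

sum-map-*ʳ : ∀ {A : Set} (f : A → ℕ) as K → sum (map f as) * K ≡ sum (map (λ a → f a * K) as)
sum-map-*ʳ f []       K = refl
sum-map-*ʳ f (a ∷ as) K = trans (*-distribʳ-+ K (f a) _) (cong (f a * K +_) (sum-map-*ʳ f as K))

admissibleWords : ∀ n → List ℕ → List (Vec ℕ n)
admissibleWords zero    μ = [] ∷ []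
admissibleWords (suc n) μ = prefixWith (admissibleWords n ∘ removeCorner μ) (nonemptyRows μ)

∈-admissibleWords⁻ : ∀ n μ {w : Vec ℕ n} → w ∈ admissibleWords n μ → Admissible μ w
∈-admissibleWords⁻ zero    μ {[]}    _  = tt
∈-admissibleWords⁻ (suc n) μ {a ∷ w} aw∈
  with ∈-prefixWith⁻ (admissibleWords n ∘ removeCorner μ) (nonemptyRows μ) aw∈
... | a∈ , w∈′ = ∈-nonemptyRows⁻ μ a∈ , ∈-admissibleWords⁻ n (removeCorner μ a) w∈′

∈-admissibleWords⁺ : ∀ n μ {w : Vec ℕ n} → Admissible μ w → w ∈ admissibleWords n μ
∈-admissibleWords⁺ zero    μ {[]}    _               = here refl
∈-admissibleWords⁺ (suc n) μ {a ∷ w} (μ[a]>0 , adm) =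
  ∈-prefixWith⁺ (admissibleWords n ∘ removeCorner μ) (∈-nonemptyRows⁺ μ a μ[a]>0)
    (∈-admissibleWords⁺ n (removeCorner μ a) adm)

admissibleWords-unique : ∀ n μ → Unique (admissibleWords n μ)
admissibleWords-unique zero    μ = [] ∷ []
admissibleWords-unique (suc n) μ =
  prefixWith-unique _ (nonemptyRows-unique μ) (admissibleWords-unique n ∘ removeCorner μ)

length-admissibleWords : ∀ n μ → Shape n μ → length (admissibleWords n μ) * ∏! μ ≡ n !
length-admissibleWords zero    μ (_ , Σμ≡0) = trans (+-identityʳ (∏! μ)) (∏!-zero μ Σμ≡0)
length-admissibleWords (suc n) μ shape@(_ , Σμ) = begin
  length (prefixWith words rows) * ∏! μ
    ≡⟨ cong (_* ∏! μ) (length-prefixWith words rows) ⟩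
  sum (map (length ∘ words) rows) * ∏! μ
    ≡⟨ sum-map-*ʳ (length ∘ words) rows (∏! μ) ⟩
  sum (map (λ a → length (words a) * ∏! μ) rows)
    ≡⟨ cong sum (map-cong-local (All.tabulate term)) ⟩
  sum (map (λ a → part μ a * n !) rows)
    ≡⟨ sym (sum-map-*ʳ (part μ) rows (n !)) ⟩
  sum (map (part μ) rows) * n !
    ≡⟨ cong (_* n !) (trans (sum-part-nonemptyRows μ) Σμ) ⟩
  suc n * n !
    ∎
  where
  open ≡-Reasoning
  rows : List ℕ
  rows = nonemptyRows μ
  words : ℕ → List (Vec ℕ n)
  words = admissibleWords n ∘ removeCorner μ
  term : ∀ {a} → a ∈ rows → length (words a) * ∏! μ ≡ part μ a * n !
  term {a} a∈ = begin
    length (words a) * ∏! μ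
      ≡⟨ cong (length (words a) *_) (sym (∏!-removeBox μ G μ[G]>0)) ⟩
    length (words a) * (∏! (removeCorner μ a) * part μ G)
      ≡⟨ sym (*-assoc (length (words a)) _ _) ⟩
    length (words a) * ∏! (removeCorner μ a) * part μ G
      ≡⟨ cong₂ _*_ (length-admissibleWords n _ (shape-removeCorner μ a shape μ[a]>0))
                   (part-corner μ a) ⟩
    n ! * part μ a
      ≡⟨ *-comm (n !) (part μ a) ⟩
    part μ a * n !
      ∎
    where
    G : ℕ
    G = corner μ a
    μ[a]>0 : 0 < part μ a
    μ[a]>0 = ∈-nonemptyRows⁻ μ a∈
    μ[G]>0 : 0 < part μ G
    μ[G]>0 = subst (0 <_) (sym (part-corner μ a)) μ[a]>0

∈-admissibleWords⇔subYamanouchi : ∀ {n μ} → Shape n μ → ∀ (w : Vec ℕ n) →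
                                  w ∈ admissibleWords n μ ⇔ SubYamanouchi μ w
∈-admissibleWords⇔subYamanouchi {n} {μ} shape w = mk⇔
  (admissible⇒subYamanouchi μ w shape ∘ ∈-admissibleWords⁻ n μ)
  (∈-admissibleWords⁺ n μ ∘ subYamanouchi⇒admissible μ w shape)

linked⇒decreasing : ∀ μ → Linked (λ a b → b ≤ a) μ → Decreasing (part μ)
linked⇒decreasing []           []       _       = z≤n
linked⇒decreasing (p ∷ [])     [-]      _       = z≤n
linked⇒decreasing (p ∷ q ∷ μ) (q≤p ∷ _) zero    = q≤p
linked⇒decreasing (p ∷ q ∷ μ) (_ ∷ μ↓)  (suc i) = linked⇒decreasing (q ∷ μ) μ↓ i

∈-map⇔ : ∀ {A B : Set} {P : A → Set} (f : A → B) {xs} → (∀ x → x ∈ xs ⇔ P x) →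
         ∀ y → y ∈ map f xs ⇔ ∃ λ x → P x × f x ≡ y
∈-map⇔ f {xs} ∈⇔P y = mk⇔ to from
  where
  to : y ∈ map f xs → ∃ λ x → _ × f x ≡ y
  to y∈ with ∈-map⁻ f y∈
  ... | x , x∈ , refl = x , Equivalence.to (∈⇔P x) x∈ , refl
  from : (∃ λ x → _ × f x ≡ y) → y ∈ map f xs
  from (x , Px , refl) = ∈-map⁺ f (Equivalence.from (∈⇔P x) Px)

mainTheorem11 : (n : ℕ) (μ : List ℕ) → IsPartition n μ →
    Σ (List (Monomial n)) λ L →
      Unique L × (∀ (m : Monomial n) → (m ∈ L) ⇔ InC n μ m) ×
      length L * product (map _! μ) ≡ n !
mainTheorem11 n μ (_ , μ-linked , Σμ≡n) =
  map reverse words ,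
  Unique.map⁺ reverse-injective (admissibleWords-unique n μ) ,
  ∈-map⇔ reverse (∈-admissibleWords⇔subYamanouchi shape) ,
  trans (cong (_* ∏! μ) (length-map reverse words)) (length-admissibleWords n μ shape)
  where
  shape : Shape n μ
  shape = linked⇒decreasing μ μ-linked , Σμ≡n
  words : List (Vec ℕ n)
  words = admissibleWords n μ
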